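{- Let $2\le k\le n'\le n$. Consider an instance $I$ with agents $1,\dots,n$ on a path, strict preferences, and initial assignment $\sigma_0(i)=o_i$, and the question whether there is a reachable assignment $\sigma$ with $\sigma(k-1)=o_{n'}$ and $\sigma(k)=o_1$. Let $I_{ -n'}$ be the instance obtained from $I$ by deleting agents $n'+1,\dots,n$ and objects $o_{n'+1},\dots,o_n$ (agents $1,\dots,n'$ on a path, preferences restricted to $\{o_1,\dots,o_{n'}\}$, agent $i$ initially holding $o_i$). Then $I$ has a reachable assignment $\sigma$ with $\sigma(k-1)=o_{n'}$ and $\sigma(k)=o_1$ if and only if $I_{ -n'}$ has a reachable assignment $\sigma$ with $\sigma(k-1)=o_{n'}$ and $\sigma(k)=o_1$.
   Context: In an instance, agents lie on a path in index order (edges between consecutive agents), each agent $i$ has a strict preference $\succ_i$ (a linear order on the objects), and agent $i$ initially holds $o_i$. A swap exchanges the objects of two adjacent agents in the current assignment and is allowed only if both agents strictly prefer the object they receive. An assignment is reachable if it results from the initial assignment by a finite sequence of allowed swaps. -}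

module Defs where

open import Data.Nat using (ℕ; suc; _≤_)
open import Data.Fin using (Fin; toℕ; inject≤; _≟_)
open import Data.Product using (∃; _×_)
open import Relation.Binary.PropositionalEquality using (_≡_)
open import Relation.Binary.Construct.Closure.ReflexiveTransitive using (Star)
open import Relation.Nullary using (yes; no)

-- Preference profile on n agents / n objects (both indexed by Fin n, 0-based:
-- agent i ↦ Fin index i-1, object o_j ↦ Fin index j-1).
-- Prefs n: P i x y  means  x ≻_i y  (agent i strictly prefers object x to y).
Prefs : ℕ → Set₁
Prefs n = Fin n → Fin n → Fin n → Set

Assignment : ℕ → Set
Assignment n = Fin n → Fin n

σ₀ : ∀ {n} → Assignment n
σ₀ i = i

swap : ∀ {n} → Assignment n → Fin n → Fin n → Assignment n
swap σ a b x with x ≟ a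
... | yes _ = σ b
... | no _ with x ≟ b
...   | yes _ = σ a
...   | no _ = σ x

data Step {n} (P : Prefs n) (σ : Assignment n) : Assignment n → Set where
  step : (a b : Fin n) → suc (toℕ a) ≡ toℕ b →
         P a (σ b) (σ a) → P b (σ a) (σ b) →
         Step P σ (swap σ a b)

Reachable : ∀ {n} → Prefs n → Assignment n → Set
Reachable P σ = Star (Step P) σ₀ σ

-- Using 1-based numbers: σ(agent x) = o_y.
Holds : ∀ {n} → Assignment n → ℕ → ℕ → Set
Holds σ x y = ∀ a → suc (toℕ a) ≡ x → suc (toℕ (σ a)) ≡ y

Target : ∀ {n} → Prefs n → ℕ → ℕ → Set
Target P k n' = ∃ λ σ → Reachable P σ × Holds σ (k Data.Nat.∸ 1) n' × Holds σ k 1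

restrict : ∀ {n n'} → n' ≤ n → Prefs n → Prefs n'
restrict le P i x y = P (inject≤ i le) (inject≤ x le) (inject≤ y le)

module Submission where

-- Along a run every agent's object only improves, so an agent never gets back an object it has
-- given away, and an object handed rightwards past an agent never returns to its left. Hence in a
-- run of I reaching the target, o_{n'} only moves left, and the agents up to its current position
-- only ever hold objects of I_{-n'}: that part of the run is a run of I_{-n'}. When o_{n'} steps
-- onto agent k - 1 it must be swapped with o_1, and afterwards neither agent k - 1 nor agent k
-- trades again. Conversely, a run of I_{-n'} is a run of I on the first n' agents.

open import Defs
open import Data.Nat using (ℕ; suc; _≤_; _<_; _≤?_; z≤n; s≤s) renaming (_≟_ to _≟ℕ_)
open import Data.Nat.Properties
  using (1+n≢n; suc-injective; ≤-refl; ≤-reflexive; ≤-trans; ≤-antisym; ≤-pred; <-trans; <-≤-trans;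
         ≤-<-trans; <⇒≤; <⇒≢; >⇒≢; <⇒≱; ≰⇒>; ≤∧≢⇒<; <-cmp; n≤1+n; n<1+n; m≤n⇒m<n∨m≡n; m∸n≤m)
open import Data.Fin using (Fin; toℕ; inject≤; fromℕ<; _≟_)
open import Data.Fin.Properties using (toℕ-injective; toℕ-inject≤; inject≤-injective; toℕ-fromℕ<; toℕ<n)
open import Data.Fin.Permutation.Components using (transpose; transpose-inverse)
open import Data.Product using (∃; _×_; _,_; proj₁; proj₂)
open import Data.Sum using (inj₁; inj₂)
open import Data.Empty using (⊥; ⊥-elim)
open import Function.Base using (_∘_)
open import Function.Definitions using (Injective)
open import Function.Bundles using (_⇔_; mk⇔)
open import Relation.Nullary using (¬_; yes; no)
open import Relation.Binary.Definitions using (tri<; tri≈; tri>)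
open import Relation.Binary.PropositionalEquality
  using (_≡_; _≢_; refl; sym; trans; cong; subst; subst₂; module ≡-Reasoning)
open import Relation.Binary.Structures using (IsStrictPartialOrder; IsStrictTotalOrder)
open import Relation.Binary.Construct.Closure.ReflexiveTransitive using (Star; ε; _◅_; _◅◅_)

Adjacent : ∀ {n} → Fin n → Fin n → Set
Adjacent a b = suc (toℕ a) ≡ toℕ b

adjacent⇒< : ∀ {n} {a b : Fin n} → Adjacent a b → toℕ a < toℕ b
adjacent⇒< = ≤-reflexive

adjacent⇒≢ : ∀ {n} {a b : Fin n} → Adjacent a b → a ≢ b
adjacent⇒≢ s refl = 1+n≢n s

module _ {n} (σ : Assignment n) where

  swap-left : ∀ a b → swap σ a b a ≡ σ b
  swap-left a b with a ≟ a
  ... | yes _   = refl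
  ... | no a≢a = ⊥-elim (a≢a refl)

  swap-right : ∀ {a b} → a ≢ b → swap σ a b b ≡ σ a
  swap-right {a} {b} a≢b with b ≟ a
  ... | yes b≡a = ⊥-elim (a≢b (sym b≡a))
  ... | no _ with b ≟ b
  ...   | yes _   = refl
  ...   | no b≢b = ⊥-elim (b≢b refl)

  swap-other : ∀ {a b x} → x ≢ a → x ≢ b → swap σ a b x ≡ σ x
  swap-other {a} {b} {x} x≢a x≢b with x ≟ a
  ... | yes x≡a = ⊥-elim (x≢a x≡a)
  ... | no _ with x ≟ b
  ...   | yes x≡b = ⊥-elim (x≢b x≡b)
  ...   | no _    = refl

  swap-away : ∀ {a b x} → toℕ x ≢ toℕ a → toℕ x ≢ toℕ b → swap σ a b x ≡ σ x
  swap-away x≢a x≢b = swap-other (x≢a ∘ cong toℕ) (x≢b ∘ cong toℕ)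

  swap≗transpose : ∀ a b x → swap σ a b x ≡ σ (transpose a b x)
  swap≗transpose a b x with x ≟ a
  ... | yes _ = refl
  ... | no _ with x ≟ b
  ...   | yes _ = refl
  ...   | no _  = refl

  swap-injective : ∀ {a b} → Injective _≡_ _≡_ σ → Injective _≡_ _≡_ (swap σ a b)
  swap-injective {a} {b} σ-inj {x} {y} eq = begin
    x                               ≡⟨ sym (transpose-inverse b a) ⟩
    transpose b a (transpose a b x) ≡⟨ cong (transpose b a) (σ-inj σ-eq) ⟩
    transpose b a (transpose a b y) ≡⟨ transpose-inverse b a ⟩
    y                               ∎
    where
    open ≡-Reasoning
    σ-eq : σ (transpose a b x) ≡ σ (transpose a b y)
    σ-eq = trans (sym (swap≗transpose a b x)) (trans eq (swap≗transpose a b y))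

  data SwapView (a b x : Fin n) : Set where
    at-left   : x ≡ a → swap σ a b x ≡ σ b → SwapView a b x
    at-right  : x ≡ b → swap σ a b x ≡ σ a → SwapView a b x
    elsewhere : x ≢ a → x ≢ b → swap σ a b x ≡ σ x → SwapView a b x

  swapView : ∀ {a b} → a ≢ b → ∀ x → SwapView a b x
  swapView {a} {b} a≢b x with x ≟ a | x ≟ b
  ... | yes refl | _        = at-left refl (swap-left a b)
  ... | no _     | yes refl = at-right refl (swap-right a≢b)
  ... | no x≢a   | no x≢b   = elsewhere x≢a x≢b (swap-other x≢a x≢b)

module Improvement {n} (P : Prefs n) (isSPO : ∀ c → IsStrictPartialOrder _≡_ (P c)) where

  private
    irrefl : ∀ {c x} → ¬ P c x x
    irrefl {c} = IsStrictPartialOrder.irrefl (isSPO c) refl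

    ≻-trans : ∀ {c x y z} → P c x y → P c y z → P c x z
    ≻-trans {c} = IsStrictPartialOrder.trans (isSPO c)

  step-stays-better : ∀ {σ σ' c x} → Step P σ σ' → P c (σ c) x → P c (σ' c) x
  step-stays-better {σ} {c = c} {x} (step a b s pa pb) better with swapView σ (adjacent⇒≢ s) c
  ... | at-left refl e    = subst (λ z → P c z x) (sym e) (≻-trans pa better)
  ... | at-right refl e   = subst (λ z → P c z x) (sym e) (≻-trans pb better)
  ... | elsewhere _ _ e   = subst (λ z → P c z x) (sym e) better

  stays-better : ∀ {σ σ' c x} → Star (Step P) σ σ' → P c (σ c) x → P c (σ' c) x
  stays-better ε          better = better
  stays-better (st ◅ run) better = stays-better run (step-stays-better st better)

  never-returns : ∀ {σ σ' c x} → Star (Step P) σ σ' → P c (σ c) x → σ' c ≢ x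
  never-returns run better refl = irrefl (stays-better run better)

  left-never-returns : ∀ {σ σ' a b} → Adjacent a b → P a (σ b) (σ a) →
                       Star (Step P) (swap σ a b) σ' → σ' a ≢ σ a
  left-never-returns {σ} {a = a} {b} _ pa run =
    never-returns run (subst (λ z → P a z (σ a)) (sym (swap-left σ a b)) pa)

  right-never-returns : ∀ {σ σ' a b} → Adjacent a b → P b (σ a) (σ b) →
                        Star (Step P) (swap σ a b) σ' → σ' b ≢ σ b
  right-never-returns {σ} {a = a} {b} s pb run =
    never-returns run (subst (λ z → P b z (σ b)) (sym (swap-right σ (adjacent⇒≢ s))) pb)

  AbsentUpTo : Assignment n → Fin n → Fin n → Set
  AbsentUpTo σ c x = ∀ i → toℕ i ≤ toℕ c → σ i ≢ x

  -- x can only enter agents 0..c through c, which would then accept something worse than it holds.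
  step-keeps-absent : ∀ {σ σ' c x} → Step P σ σ' → P c (σ c) x → AbsentUpTo σ c x → AbsentUpTo σ' c x
  step-keeps-absent {σ} {c = c} {x} (step a b s pa pb) better absent i i≤c
    with swapView σ (adjacent⇒≢ s) i
  ... | elsewhere _ _ e = λ eq → absent i i≤c (trans (sym e) eq)
  ... | at-right refl e = λ eq → absent a a≤c (trans (sym e) eq)
    where a≤c = ≤-trans (n≤1+n (toℕ a)) (subst (_≤ toℕ c) (sym s) i≤c)
  ... | at-left refl e with toℕ b ≤? toℕ c
  ...   | yes b≤c = λ eq → absent b b≤c (trans (sym e) eq)
  ...   | no b≰c  = λ eq → irrefl (≻-trans (subst₂ (λ u z → P u z (σ u)) a≡c (trans (sym e) eq) pa) better)
    where
    a≡c : a ≡ c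
    a≡c = toℕ-injective (≤-antisym i≤c (≤-pred (subst (toℕ c <_) (sym s) (≰⇒> b≰c))))

  keeps-absent : ∀ {σ σ' c x} → Star (Step P) σ σ' → P c (σ c) x → AbsentUpTo σ c x → AbsentUpTo σ' c x
  keeps-absent ε          better absent = absent
  keeps-absent (st ◅ run) better absent =
    keeps-absent run (step-stays-better st better) (step-keeps-absent st better absent)

  left-stays-right : ∀ {σ σ' a b} → Injective _≡_ _≡_ σ → Adjacent a b → P a (σ b) (σ a) →
                     Star (Step P) (swap σ a b) σ' → AbsentUpTo σ' a (σ a)
  left-stays-right {σ} {a = a} {b} σ-inj s pa run =
    keeps-absent run (subst (λ z → P a z (σ a)) (sym (swap-left σ a b)) pa) absent
    where
    absent : AbsentUpTo (swap σ a b) a (σ a)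
    absent i i≤a eq = <⇒≱ (adjacent⇒< s) (subst (λ z → toℕ z ≤ toℕ a) i≡b i≤a)
      where
      i≡b : i ≡ b
      i≡b = swap-injective σ σ-inj (trans eq (sym (swap-right σ (adjacent⇒≢ s))))

data Side {n} (q : ℕ) (a b : Fin n) : Set where
  left-of   : toℕ b < q → Side q a b
  ends-at   : toℕ b ≡ q → Side q a b
  starts-at : toℕ a ≡ q → Side q a b
  right-of  : q < toℕ a → Side q a b

side : ∀ {n} q {a b : Fin n} → Adjacent a b → Side q a b
side q {a} {b} s with <-cmp (toℕ a) q
... | tri> _ _ q<a = right-of q<a
... | tri≈ _ a≡q _ = starts-at a≡q
... | tri< a<q _ _ with <-cmp (toℕ b) q
...   | tri< b<q _ _ = left-of b<q
...   | tri≈ _ b≡q _ = ends-at b≡q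
...   | tri> _ _ q<b = ⊥-elim (<⇒≱ q<b (subst (_≤ q) s a<q))

ObjAt : ∀ {n} → Assignment n → ℕ → ℕ → Set
ObjAt σ q v = ∀ i → toℕ i ≡ q → toℕ (σ i) ≡ v

Holds⇒ObjAt : ∀ {n} {σ : Assignment n} {q v} → Holds σ (suc q) (suc v) → ObjAt σ q v
Holds⇒ObjAt h i i≡q = suc-injective (h i (cong suc i≡q))

ObjAt⇒Holds : ∀ {n} {σ : Assignment n} {q v} → ObjAt σ q v → Holds σ (suc q) (suc v)
ObjAt⇒Holds at i i≡q = cong suc (at i (suc-injective i≡q))

ObjAt-same : ∀ {n} {σ σ' : Assignment n} {q q' v c d} → ObjAt σ q v → ObjAt σ' q' v →
             toℕ c ≡ q → toℕ d ≡ q' → σ c ≡ σ' d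
ObjAt-same at at' c≡q d≡q' = toℕ-injective (trans (at _ c≡q) (sym (at' _ d≡q')))

ObjAt-here : ∀ {n} {σ : Assignment n} {c v} → toℕ (σ c) ≡ v → ObjAt σ (toℕ c) v
ObjAt-here {σ = σ} {v = v} h i i≡c = subst (λ z → toℕ (σ z) ≡ v) (sym (toℕ-injective i≡c)) h

ObjAt-swap : ∀ {n} {σ : Assignment n} {a b q v} → q ≢ toℕ a → q ≢ toℕ b →
             ObjAt σ q v → ObjAt (swap σ a b) q v
ObjAt-swap {σ = σ} q≢a q≢b at i refl = trans (cong toℕ (swap-away σ q≢a q≢b)) (at i refl)

ObjAt-swap-left-of : ∀ {n} {σ : Assignment n} {a b q v} → Adjacent a b → toℕ b < q →
                     ObjAt σ q v → ObjAt (swap σ a b) q v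
ObjAt-swap-left-of s b<q = ObjAt-swap (>⇒≢ (<-trans (adjacent⇒< s) b<q)) (>⇒≢ b<q)

ObjAt-swap-right-of : ∀ {n} {σ : Assignment n} {a b q v} → Adjacent a b → q < toℕ a →
                      ObjAt σ q v → ObjAt (swap σ a b) q v
ObjAt-swap-right-of s q<a = ObjAt-swap (<⇒≢ q<a) (<⇒≢ (<-trans q<a (adjacent⇒< s)))

ObjAt-swapˡ : ∀ {n} {σ : Assignment n} {a b v} → ObjAt σ (toℕ b) v → ObjAt (swap σ a b) (toℕ a) v
ObjAt-swapˡ {σ = σ} {a} {b} at i i≡a
  rewrite toℕ-injective i≡a = trans (cong toℕ (swap-left σ a b)) (at b refl)

ObjAt-swapʳ : ∀ {n} {σ : Assignment n} {a b v} → a ≢ b → ObjAt σ (toℕ a) v → ObjAt (swap σ a b) (toℕ b) v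
ObjAt-swapʳ {σ = σ} {a} {b} a≢b at i i≡b
  rewrite toℕ-injective i≡b = trans (cong toℕ (swap-right σ a≢b)) (at a refl)

NoZeroFrom : ∀ {n} → Assignment n → ℕ → Set
NoZeroFrom σ q = ∀ i → q ≤ toℕ i → toℕ (σ i) ≢ 0

NoZeroFrom-swap-left-of : ∀ {n} {σ : Assignment n} {a b q} → Adjacent a b → toℕ b < q →
                          NoZeroFrom σ q → NoZeroFrom (swap σ a b) q
NoZeroFrom-swap-left-of {σ = σ} {a} {b} s b<q nz i q≤i =
  subst (λ z → toℕ z ≢ 0) (sym (swap-away σ (>⇒≢ a<i) (>⇒≢ b<i))) (nz i q≤i)
  where
  b<i = <-≤-trans b<q q≤i
  a<i = <-trans (adjacent⇒< s) b<i

NoZeroFrom-swap-right-of : ∀ {n} {σ : Assignment n} {a b q} → Adjacent a b → q ≤ toℕ a →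
                           NoZeroFrom σ q → NoZeroFrom (swap σ a b) q
NoZeroFrom-swap-right-of {σ = σ} {a} {b} s q≤a nz i q≤i with swapView σ (adjacent⇒≢ s) i
... | at-left refl e  = subst (λ z → toℕ z ≢ 0) (sym e) (nz b (≤-trans q≤a (<⇒≤ (adjacent⇒< s))))
... | at-right refl e = subst (λ z → toℕ z ≢ 0) (sym e) (nz a q≤a)
... | elsewhere _ _ e = subst (λ z → toℕ z ≢ 0) (sym e) (nz i q≤i)

NoZeroFrom-swap-ends-at : ∀ {n} {σ : Assignment n} {a b} → Adjacent a b → toℕ (σ a) ≢ 0 →
                          NoZeroFrom σ (toℕ b) → NoZeroFrom (swap σ a b) (toℕ a)
NoZeroFrom-swap-ends-at {σ = σ} {a} {b} s a↛0 nz = NoZeroFrom-swap-right-of s ≤-refl nz-a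
  where
  nz-a : NoZeroFrom σ (toℕ a)
  nz-a i a≤i with m≤n⇒m<n∨m≡n a≤i
  ... | inj₁ a<i = nz i (subst (_≤ toℕ i) s a<i)
  ... | inj₂ a≡i = subst (λ z → toℕ (σ z) ≢ 0) (toℕ-injective a≡i) a↛0

module Window {n m} (P : Prefs n) (le : suc m ≤ n) where

  R : Prefs (suc m)
  R = restrict le P

  ι : Fin (suc m) → Fin n
  ι i = inject≤ i le

  ι-injective : Injective _≡_ _≡_ ι
  ι-injective = inject≤-injective le le _ _

  ι-adjacent : ∀ {a b} → Adjacent a b → Adjacent (ι a) (ι b)
  ι-adjacent {a} {b} s rewrite toℕ-inject≤ a le | toℕ-inject≤ b le = s

  data InWindow : Fin n → Set where
    image : (a : Fin (suc m)) → InWindow (ι a)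

  inWindow : ∀ a → toℕ a ≤ m → InWindow a
  inWindow a a≤m = subst InWindow ι-lower (image lower)
    where
    lower = fromℕ< (s≤s a≤m)
    ι-lower : ι lower ≡ a
    ι-lower = toℕ-injective (trans (toℕ-inject≤ lower le) (toℕ-fromℕ< (s≤s a≤m)))

  AgreeUpTo : ℕ → Assignment n → Assignment (suc m) → Set
  AgreeUpTo p σ τ = ∀ i → toℕ i ≤ p → σ (ι i) ≡ ι (τ i)

  agree-mono : ∀ {p q σ τ} → q ≤ p → AgreeUpTo p σ τ → AgreeUpTo q σ τ
  agree-mono q≤p agree i i≤q = agree i (≤-trans i≤q q≤p)

  agree-swap : ∀ {p σ τ a b} → Adjacent a b → toℕ b ≤ p →
               AgreeUpTo p σ τ → AgreeUpTo p (swap σ (ι a) (ι b)) (swap τ a b)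
  agree-swap {p} {σ} {τ} {a} {b} s b≤p agree i i≤p with swapView τ (adjacent⇒≢ s) i
  ... | at-left refl e  = trans (swap-left σ (ι a) (ι b)) (trans (agree b b≤p) (cong ι (sym e)))
  ... | at-right refl e = trans (swap-right σ (adjacent⇒≢ (ι-adjacent s)))
                                (trans (agree a a≤p) (cong ι (sym e)))
    where a≤p = ≤-trans (n≤1+n (toℕ a)) (subst (_≤ p) (sym s) b≤p)
  ... | elsewhere i≢a i≢b e = trans (swap-other σ (i≢a ∘ ι-injective) (i≢b ∘ ι-injective))
                                    (trans (agree i i≤p) (cong ι (sym e)))

  agree-swap-right-of : ∀ {p σ τ a b} → Adjacent a b → p < toℕ a →
                        AgreeUpTo p σ τ → AgreeUpTo p (swap σ a b) τ
  agree-swap-right-of {σ = σ} {a = a} {b} s p<a agree i i≤p =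
    trans (swap-away σ (<⇒≢ i<a) (<⇒≢ (<-trans i<a (adjacent⇒< s)))) (agree i i≤p)
    where
    i<a : toℕ (ι i) < toℕ a
    i<a = subst (_< toℕ a) (sym (toℕ-inject≤ i le)) (≤-<-trans i≤p p<a)

  restrict-step : ∀ {p σ τ a b} → Adjacent a b → toℕ b ≤ p → p ≤ m →
                  P a (σ b) (σ a) → P b (σ a) (σ b) → AgreeUpTo p σ τ →
                  ∃ λ τ' → Step R τ τ' × AgreeUpTo p (swap σ a b) τ'
  restrict-step {p} {σ} {τ} {a} {b} s b≤p p≤m pa pb agree
    with inWindow a (≤-trans (<⇒≤ (adjacent⇒< s)) b≤m) | inWindow b b≤m
    where b≤m = ≤-trans b≤p p≤m
  ... | image a' | image b' = swap τ a' b' , step a' b' s' pa' pb' , agree-swap s' b'≤p agree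
    where
    s' : Adjacent a' b'
    s' = subst₂ (λ x y → suc x ≡ y) (toℕ-inject≤ a' le) (toℕ-inject≤ b' le) s
    b'≤p : toℕ b' ≤ p
    b'≤p = subst (_≤ p) (toℕ-inject≤ b' le) b≤p
    a'≤p : toℕ a' ≤ p
    a'≤p = ≤-trans (n≤1+n (toℕ a')) (subst (_≤ p) (sym s') b'≤p)
    pa' : R a' (τ b') (τ a')
    pa' = subst₂ (P (ι a')) (agree b' b'≤p) (agree a' a'≤p) pa
    pb' : R b' (τ a') (τ b')
    pb' = subst₂ (P (ι b')) (agree a' a'≤p) (agree b' b'≤p) pb

  extend-step : ∀ {σ τ τ'} → Step R τ τ' → AgreeUpTo m σ τ →
                ∃ λ σ' → Step P σ σ' × AgreeUpTo m σ' τ'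
  extend-step {σ} (step a b s pa pb) agree =
    swap σ (ι a) (ι b) , step (ι a) (ι b) (ι-adjacent s) pa' pb' , agree-swap s b≤m agree
    where
    a≤m = ≤-pred (toℕ<n a)
    b≤m = ≤-pred (toℕ<n b)
    pa' : P (ι a) (σ (ι b)) (σ (ι a))
    pa' = subst₂ (P (ι a)) (sym (agree b b≤m)) (sym (agree a a≤m)) pa
    pb' : P (ι b) (σ (ι a)) (σ (ι b))
    pb' = subst₂ (P (ι b)) (sym (agree a a≤m)) (sym (agree b b≤m)) pb

  extend-run : ∀ {σ τ τ'} → Star (Step R) τ τ' → AgreeUpTo m σ τ →
               ∃ λ σ' → Star (Step P) σ σ' × AgreeUpTo m σ' τ'
  extend-run ε agree = _ , ε , agree
  extend-run (st ◅ run) agree with extend-step st agree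
  ... | _ , st' , agree' with extend-run run agree'
  ...   | _ , run' , agree'' = _ , st' ◅ run' , agree''

  ObjAt-restrict : ∀ {p σ τ q v} → q ≤ p → AgreeUpTo p σ τ → ObjAt σ q v → ObjAt τ q v
  ObjAt-restrict {σ = σ} {τ} {v = v} q≤p agree at i refl = begin
    toℕ (τ i)     ≡⟨ sym (toℕ-inject≤ (τ i) le) ⟩
    toℕ (ι (τ i)) ≡⟨ cong toℕ (sym (agree i q≤p)) ⟩
    toℕ (σ (ι i)) ≡⟨ at (ι i) (toℕ-inject≤ i le) ⟩
    v             ∎
    where open ≡-Reasoning

  Holds-extend : ∀ {σ τ x v} → x ≤ suc m → AgreeUpTo m σ τ → Holds τ x v → Holds σ x v
  Holds-extend {σ} {τ} {v = v} x≤1+m agree h a refl with inWindow a (≤-pred x≤1+m)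
  ... | image a' = begin
    suc (toℕ (σ (ι a')))  ≡⟨ cong (suc ∘ toℕ) (agree a' (≤-pred (toℕ<n a'))) ⟩
    suc (toℕ (ι (τ a')))  ≡⟨ cong suc (toℕ-inject≤ (τ a') le) ⟩
    suc (toℕ (τ a'))      ≡⟨ h a' (cong suc (sym (toℕ-inject≤ a' le))) ⟩
    v                     ∎
    where open ≡-Reasoning

  restricted⇒full : ∀ {k v} → k ≤ suc m → Target R k v → Target P k v
  restricted⇒full k≤1+m (τ , run , h₁ , h₂) with extend-run run (λ _ _ → refl)
  ... | σ , run' , agree =
    σ , run' , Holds-extend (≤-trans (m∸n≤m _ 1) k≤1+m) agree h₁ , Holds-extend k≤1+m agree h₂

-- Positions and objects are 0-based: agent k - 1 sits at position j, o_{n'} is object m, o_1 is object 0.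
module Forward {n m j} (P : Prefs n) (isSPO : ∀ c → IsStrictPartialOrder _≡_ (P c))
               (le : suc m ≤ n) (j<m : j < m) where

  open Improvement P isSPO
  open Window P le

  Final : Assignment n → Set
  Final σ = ObjAt σ j m × ObjAt σ (suc j) 0

  Goal : Set
  Goal = Target R (suc (suc j)) (suc m)

  Final-swap-left-of : ∀ {σ a b} → Adjacent a b → toℕ b < j → Final σ → Final (swap σ a b)
  Final-swap-left-of s b<j (at-m , at-0) =
    ObjAt-swap-left-of s b<j at-m , ObjAt-swap-left-of s (<-trans b<j (n<1+n j)) at-0

  Final-swap-right-of : ∀ {σ a b} → Adjacent a b → suc j < toℕ a → Final σ → Final (swap σ a b)
  Final-swap-right-of s 1+j<a (at-m , at-0) =
    ObjAt-swap-right-of s (<-trans (n<1+n j) 1+j<a) at-m , ObjAt-swap-right-of s 1+j<a at-0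

  Final-swap-ends-at : ∀ {σ a b} → Adjacent a b → toℕ a ≡ j → ObjAt σ (toℕ b) m → toℕ (σ a) ≡ 0 →
                       Final (swap σ a b)
  Final-swap-ends-at {σ} {a} {b} s a≡j at-m a↦0 =
    subst (λ q → ObjAt (swap σ a b) q m) a≡j (ObjAt-swapˡ at-m) ,
    subst (λ q → ObjAt (swap σ a b) q 0) b≡1+j (ObjAt-swapʳ (adjacent⇒≢ s) (ObjAt-here a↦0))
    where b≡1+j = trans (sym s) (cong suc a≡j)

  j<left : ∀ {a b : Fin n} → Adjacent a b → suc j ≤ toℕ b → toℕ a ≢ j → j < toℕ a
  j<left s 1+j≤b a≢j = ≤∧≢⇒< (≤-pred (subst (suc j ≤_) (sym s) 1+j≤b)) (a≢j ∘ sym)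

  agent : ∀ q → q ≤ m → Fin n
  agent q q≤m = fromℕ< (<-≤-trans (s≤s q≤m) le)

  toℕ-agent : ∀ q q≤m → toℕ (agent q q≤m) ≡ q
  toℕ-agent q q≤m = toℕ-fromℕ< _

  finish : ∀ {p σ τ} → suc j ≤ p → AgreeUpTo p σ τ → Reachable R τ → Final σ → Goal
  finish {τ = τ} j<p agree reached (at-m , at-0) =
    τ , reached , ObjAt⇒Holds (ObjAt-restrict (<⇒≤ j<p) agree at-m)
                , ObjAt⇒Holds (ObjAt-restrict j<p agree at-0)

  -- Agent k - 1 would lose o_{n'} for good by trading, so o_1 can never get past it.
  blocked : ∀ {σ σ'} → Star (Step P) σ σ' → Final σ' → ObjAt σ j m → NoZeroFrom σ j → ⊥
  blocked ε (_ , at-0) _ nz = nz c (subst (j ≤_) (sym c≡1+j) (n≤1+n j)) (at-0 c c≡1+j)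
    where
    c = agent (suc j) j<m
    c≡1+j = toℕ-agent (suc j) j<m
  blocked (step a b s pa pb ◅ run) final at nz with side j s
  ... | left-of b<j   = blocked run final (ObjAt-swap-left-of s b<j at)
                                          (NoZeroFrom-swap-left-of s b<j nz)
  ... | ends-at b≡j   = right-never-returns s pb run (ObjAt-same (proj₁ final) at b≡j b≡j)
  ... | starts-at a≡j = left-never-returns s pa run (ObjAt-same (proj₁ final) at a≡j a≡j)
  ... | right-of j<a  = blocked run final (ObjAt-swap-right-of s j<a at)
                                          (NoZeroFrom-swap-right-of s (<⇒≤ j<a) nz)

  settled : ∀ {σ σ' τ} → Star (Step P) σ σ' → Final σ' →
            Final σ → AgreeUpTo (suc j) σ τ → Reachable R τ → Goal
  settled ε final _ agree reached = finish ≤-refl agree reached final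
  settled (step a b s pa pb ◅ run) final now agree reached with side j s
  ... | left-of b<j with restrict-step s (<⇒≤ (<-trans b<j (n<1+n j))) j<m pa pb agree
  ...   | τ' , st , agree' = settled run final (Final-swap-left-of s b<j now) agree' (reached ◅◅ st ◅ ε)
  settled (step a b s pa pb ◅ run) final now agree reached | ends-at b≡j =
    ⊥-elim (right-never-returns s pb run (ObjAt-same (proj₁ final) (proj₁ now) b≡j b≡j))
  settled (step a b s pa pb ◅ run) final now agree reached | starts-at a≡j =
    ⊥-elim (left-never-returns s pa run (ObjAt-same (proj₁ final) (proj₁ now) a≡j a≡j))
  settled (step a b s pa pb ◅ run) final now agree reached | right-of j<a with m≤n⇒m<n∨m≡n j<a
  ... | inj₁ 1+j<a =
    settled run final (Final-swap-right-of s 1+j<a now) (agree-swap-right-of s 1+j<a agree) reached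
  ... | inj₂ 1+j≡a =
    ⊥-elim (left-never-returns s pa run (ObjAt-same (proj₂ final) (proj₂ now) (sym 1+j≡a) (sym 1+j≡a)))

  travel : ∀ {p σ σ' τ} → suc j ≤ p → p ≤ m → Star (Step P) σ σ' → Final σ' →
           Injective _≡_ _≡_ σ → ObjAt σ p m → NoZeroFrom σ p → AgreeUpTo p σ τ → Reachable R τ → Goal
  travel j<p _ ε final _ _ _ agree reached = finish j<p agree reached final
  travel {σ = σ} j<p p≤m (step a b s pa pb ◅ run) final inj at nz agree reached with side _ s
  ... | left-of b<p with restrict-step s (<⇒≤ b<p) p≤m pa pb agree
  ...   | τ' , st , agree' =
    travel j<p p≤m run final (swap-injective σ inj) (ObjAt-swap-left-of s b<p at)
           (NoZeroFrom-swap-left-of s b<p nz) agree' (reached ◅◅ st ◅ ε)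
  travel {σ = σ} j<p p≤m (step a b s pa pb ◅ run) final inj at nz agree reached | right-of p<a =
    travel j<p p≤m run final (swap-injective σ inj) (ObjAt-swap-right-of s p<a at)
           (NoZeroFrom-swap-right-of s (<⇒≤ p<a) nz) (agree-swap-right-of s p<a agree) reached
  travel j<p p≤m (step a b s pa pb ◅ run) final inj at nz agree reached | starts-at refl =
    ⊥-elim (left-stays-right inj s pa run c (subst (_≤ toℕ a) (sym c≡j) (<⇒≤ j<p))
                             (ObjAt-same (proj₁ final) at c≡j refl))
    where
    c = agent j (<⇒≤ j<m)
    c≡j = toℕ-agent j (<⇒≤ j<m)
  travel {σ = σ} j<p p≤m (step a b s pa pb ◅ run) final inj at nz agree reached | ends-at refl
    with restrict-step s ≤-refl p≤m pa pb agree | toℕ a ≟ℕ j | toℕ (σ a) ≟ℕ 0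
  ... | τ' , st , agree' | yes a≡j | yes a↦0 =
    settled run final (Final-swap-ends-at s a≡j at a↦0) (agree-mono {σ = swap σ a b} j<p agree')
            (reached ◅◅ st ◅ ε)
  ... | _ | yes a≡j | no a↛0 =
    ⊥-elim (blocked run final (subst (λ q → ObjAt (swap σ a b) q m) a≡j (ObjAt-swapˡ at))
                              (subst (NoZeroFrom (swap σ a b)) a≡j (NoZeroFrom-swap-ends-at s a↛0 nz)))
  ... | _ | no a≢j | yes a↦0 =
    ⊥-elim (left-stays-right inj s pa run c (subst (_≤ toℕ a) (sym c≡1+j) (j<left s j<p a≢j))
                             (ObjAt-same (proj₂ final) (ObjAt-here {σ = σ} a↦0) c≡1+j refl))
    where
    c = agent (suc j) j<m
    c≡1+j = toℕ-agent (suc j) j<m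
  ... | τ' , st , agree' | no a≢j | no a↛0 =
    travel (j<left s j<p a≢j) (≤-trans (<⇒≤ (adjacent⇒< s)) p≤m) run final
           (swap-injective σ inj) (ObjAt-swapˡ at) (NoZeroFrom-swap-ends-at s a↛0 nz)
           (agree-mono {σ = swap σ a b} (<⇒≤ (adjacent⇒< s)) agree') (reached ◅◅ st ◅ ε)

  full⇒restricted : Target P (suc (suc j)) (suc m) → Goal
  full⇒restricted (σ , run , h₁ , h₂) =
    travel j<m ≤-refl run (Holds⇒ObjAt h₁ , Holds⇒ObjAt h₂) (λ eq → eq) (λ _ eq → eq) nz₀ (λ _ _ → refl) ε
    where
    nz₀ : NoZeroFrom σ₀ m
    nz₀ i m≤i i≡0 = <⇒≱ (≤-<-trans z≤n j<m) (subst (m ≤_) i≡0 m≤i)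

lemma6 : (n n' k : ℕ) → (P : Prefs n) →
         ((i : Fin n) → IsStrictTotalOrder _≡_ (P i)) →
         2 ≤ k → k ≤ n' → (le : n' ≤ n) →
         Target P k n' ⇔ Target (restrict le P) k n'
lemma6 n .(suc m) .(suc (suc j)) P isSTO (s≤s (s≤s {n = j} z≤n)) k≤n'@(s≤s {n = m} j<m) le =
  mk⇔ (Forward.full⇒restricted P (IsStrictTotalOrder.isStrictPartialOrder ∘ isSTO) le j<m)
      (Window.restricted⇒full P le k≤n')
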